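{- For every $n\geq1$ and every permutation $\sigma\in S_n$, $\mathrm{Des}_1(\sigma)\subseteq\mathrm{Des}(\varepsilon\sigma)$, where $(\varepsilon\sigma)(j)=\varepsilon(\sigma(j))$.
   Context: $\varepsilon\in S_n$ is the involution swapping $2i$ and $2i+1$ for each $i\geq1$ with $2i+1\le n$ (fixing all other elements). $\mathrm{Des}(w)=\{j\in[n-1]:w(j)>w(j+1)\}$ and $\mathrm{Des}_1(w)=\{j\in[n-1]:w(j)>w(j+1)+1\}$. -}

module Defs where

open import Data.Nat using (ℕ; zero; suc; _+_; _<_; _≤_)
open import Data.Nat.Properties using (_≤?_; _<?_)
open import Data.Bool using (Bool; true; false; if_then_else_)
open import Data.Product using (_×_)
open import Data.Fin using (Fin; toℕ; fromℕ<)
open import Data.Fin.Permutation using (Permutation′; _⟨$⟩ʳ_)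
open import Relation.Nullary.Decidable using (yes; no; ⌊_⌋)

-- We use 1-based values/positions as in the paper: position j ∈ {1,…,n}
-- corresponds to index j-1 : Fin n, and value k : Fin n stands for k+1.

even? : ℕ → Bool
even? zero = true
even? (suc zero) = false
even? (suc (suc k)) = even? k

-- ε ∈ S_n acting on values v ∈ {1,…,n}: swaps 2i and 2i+1 whenever i ≥ 1
-- and 2i+1 ≤ n, fixes all other values.
ε : (n : ℕ) → ℕ → ℕ
ε n zero = zero
ε n (suc zero) = 1
ε n (suc (suc k)) =
  if even? k
  then (if ⌊ 3 + k ≤? n ⌋ then 3 + k else 2 + k)
  else 1 + k

-- one-line notation: oneLine σ j = σ(j) ∈ {1,…,n} for positions 1 ≤ j ≤ n
-- (value 0 outside this range, never used by Des/Des₁ below).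
oneLine : {n : ℕ} → Permutation′ n → ℕ → ℕ
oneLine {n} σ zero = 0
oneLine {n} σ (suc i) with i <? n
... | yes i<n = suc (toℕ (σ ⟨$⟩ʳ fromℕ< i<n))
... | no _ = 0

InDes : (n : ℕ) → (ℕ → ℕ) → ℕ → Set
InDes n w j = (1 ≤ j × j < n) × w (suc j) < w j

InDes₁ : (n : ℕ) → (ℕ → ℕ) → ℕ → Set
InDes₁ n w j = (1 ≤ j × j < n) × w (suc j) + 1 < w j

module Submission where

-- ε moves every value by at most one, upwards only from even values and
-- downwards only from odd ones. So if b + 1 < a, then ε b ≤ b + 1 ≤ a − 1 ≤ ε a,
-- and equality throughout would make b move up and a = b + 2 move down,
-- although b and b + 2 have the same parity.

open import Defs
open import Data.Nat using (ℕ; zero; suc; _+_; _≤_; _<_; _≤?_; s≤s; z≤n)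
open import Data.Nat.Properties
  using (≤-refl; ≤-trans; ≤-antisym; ≤-pred; n≤1+n; ≤∧≢⇒<; suc-injective; +-comm; 1+n≢n; m≢1+n+m)
open import Data.Bool using (true; false)
open import Data.Empty using (⊥-elim)
open import Data.Product using (_×_; _,_)
open import Data.Fin.Permutation using (Permutation′)
open import Relation.Nullary.Decidable using (yes; no)
open import Relation.Binary.PropositionalEquality using (_≡_; _≢_; refl; sym; trans; cong; subst)

≤-chain-collapse : ∀ {x y z w : ℕ} → x ≤ y → y ≤ z → z ≤ w → x ≡ w →
                   x ≡ y × y ≡ z × z ≡ w
≤-chain-collapse x≤y y≤z z≤w refl =
    ≤-antisym x≤y (≤-trans y≤z z≤w)
  , ≤-antisym y≤z (≤-trans z≤w x≤y)
  , ≤-antisym z≤w (≤-trans x≤y y≤z)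

module ParityRespectingShift
  (f : ℕ → ℕ)
  (f≤1+v : ∀ v → f v ≤ suc v)
  (v≤1+f : ∀ v → v ≤ suc (f v))
  (f≡1+v⇒even : ∀ v → f v ≡ suc v → even? v ≡ true)
  (1+f≡v⇒odd : ∀ v → suc (f v) ≡ v → even? v ≡ false)
  where

  strictMono-at-distance-2 : ∀ {a b} → suc (suc b) ≤ a → f b < f a
  strictMono-at-distance-2 {a} {b} 2+b≤a =
    ≤∧≢⇒< (≤-pred (≤-trans (s≤s (f≤1+v b)) (≤-trans 2+b≤a (v≤1+f a)))) fb≢fa
    where
    fb≢fa : f b ≢ f a
    fb≢fa fb≡fa
      with ≤-chain-collapse (s≤s (f≤1+v b)) 2+b≤a (v≤1+f a) (cong suc fb≡fa)
    ... | moves-up , refl , moves-down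
      with trans (sym (f≡1+v⇒even b (suc-injective moves-up)))
                 (1+f≡v⇒odd (suc (suc b)) (sym moves-down))
    ... | ()

ε-≤-suc : ∀ n v → ε n v ≤ suc v
ε-≤-suc n zero = z≤n
ε-≤-suc n (suc zero) = s≤s z≤n
ε-≤-suc n (suc (suc k)) with even? k | 3 + k ≤? n
... | true  | yes _ = ≤-refl
... | true  | no _  = n≤1+n _
... | false | _     = ≤-trans (n≤1+n _) (n≤1+n _)

≤-suc-ε : ∀ n v → v ≤ suc (ε n v)
≤-suc-ε n zero = z≤n
≤-suc-ε n (suc zero) = s≤s z≤n
≤-suc-ε n (suc (suc k)) with even? k | 3 + k ≤? n
... | true  | yes _ = ≤-trans (n≤1+n _) (n≤1+n _)
... | true  | no _  = n≤1+n _
... | false | _     = ≤-refl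

ε≡suc⇒even : ∀ n v → ε n v ≡ suc v → even? v ≡ true
ε≡suc⇒even n (suc (suc k)) e with even? k | 3 + k ≤? n
... | true  | yes _ = refl
... | true  | no _  = ⊥-elim (1+n≢n (sym e))
... | false | _     = ⊥-elim (m≢1+n+m (suc k) {1} e)

suc-ε≡⇒odd : ∀ n v → suc (ε n v) ≡ v → even? v ≡ false
suc-ε≡⇒odd n (suc (suc k)) e with even? k | 3 + k ≤? n
... | true  | yes _ = ⊥-elim (m≢1+n+m (suc (suc k)) {1} (sym e))
... | true  | no _  = ⊥-elim (1+n≢n e)
... | false | _     = refl

ε-strictMono-at-distance-2 : ∀ n {a b} → b + 1 < a → ε n b < ε n a
ε-strictMono-at-distance-2 n {a} {b} b+1<a =
  strictMono-at-distance-2 (subst (λ m → suc m ≤ a) (+-comm b 1) b+1<a)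
  where open ParityRespectingShift (ε n) (ε-≤-suc n) (≤-suc-ε n) (ε≡suc⇒even n) (suc-ε≡⇒odd n)

mainTheorem9 : (n : ℕ) → 1 ≤ n → (σ : Permutation′ n) → (j : ℕ) →
                 InDes₁ n (oneLine σ) j →
                 InDes n (λ i → ε n (oneLine σ i)) j
mainTheorem9 n _ σ j (j∈[n-1] , gap) = j∈[n-1] , ε-strictMono-at-distance-2 n gap
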